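{- For all integers $m\ge 1$ and $k\ge m+1$ there is a constant $c>0$ depending only on $m$ and $k$ such that for all positive integers $n,d$, with $N=n^d$, \[ r_m(k,N)\ \geq\ N\,\frac{r_{2m}(k,n^2d)}{c^d\,n^2d}. \]
   Context: For integers $m\ge 1$, $k\ge 2$, $M\ge 1$, $r_m(k,M)$ denotes the maximal cardinality of a subset $A\subseteq\{0,1,\ldots,M-1\}$ such that there do not exist integers $x,a_1,\ldots,a_m$, with at least one $a_i\neq 0$, for which $x+\sum_{i=1}^m a_i j^i\in A$ for every $j=0,1,\ldots,k-1$. (The $a_i$ need not belong to $A$, and the values $x+\sum_i a_ij^i$ need not be distinct.) -}

module Defs where

open import Data.Nat using (ℕ; zero; suc; _≤_)
open import Data.Integer using (ℤ; +_; _+_; _*_; _^_)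
open import Data.Fin using (Fin; toℕ)
open import Data.Fin.Subset using (Subset; _∈_; ∣_∣)
open import Data.Product using (Σ; ∃; _×_; _,_)
open import Relation.Binary.PropositionalEquality using (_≡_; _≢_)
open import Relation.Nullary using (¬_)

-- Σ_{i=1}^{m} a_i j^i, with a : Fin m → ℤ, a (i) standing for a_{i+1}
polySum : (m : ℕ) → (Fin m → ℤ) → ℤ → ℤ
polySum zero    a j = + 0
polySum (suc m) a j = a Fin.zero * j ^ 1 + polySum m (λ i → a (Fin.suc i)) j * j
  where import Data.Fin as Fin

_∈ℤ_ : {M : ℕ} → ℤ → Subset M → Set
_∈ℤ_ {M} z A = Σ (Fin M) λ f → (+ toℕ f ≡ z) × (f ∈ A)

HasConfig : (m k M : ℕ) → Subset M → Set
HasConfig m k M A =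
  Σ ℤ λ x → Σ (Fin m → ℤ) λ a →
    (Σ (Fin m) λ i → a i ≢ + 0) ×
    ((j : Fin k) → (x + polySum m a (+ toℕ j)) ∈ℤ A)

Free : (m k M : ℕ) → Subset M → Set
Free m k M A = ¬ HasConfig m k M A

IsR : (m k M r : ℕ) → Set
IsR m k M r =
  (Σ (Subset M) λ A → Free m k M A × ∣ A ∣ ≡ r) ×
  ((A : Subset M) → Free m k M A → ∣ A ∣ ≤ r)

{-# OPTIONS --safe #-}
-- Write numbers below N = n^d in base n and keep the "good" ones, all of whose digits lie in
-- {0, D, 2D, …, QD} with D = (k!)^m, Q = ⌊n/C⌋, C = 2^(m+2) D; there are at least (Q+1)^d ≥ (n/C)^d.
-- Let x + P(j), j < k, be a progression of good numbers with deg P ≤ m < k. Newton interpolation on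
-- the k nodes, digit by digit, shows that every digit is itself a polynomial of degree ≤ m in j:
-- divided differences of multiples of (k!)^m stay integral, and digits below n/2^(m+1) never carry.
-- Hence the digit norm ν(i) = Σ_t digit_t(i)² ∈ [0, n²d] is, along the progression, a polynomial of
-- degree ≤ 2m in j, nonconstant because some digit polynomial is nonconstant and hence unbounded.
-- So for B ⊆ [0, n²d) free of degree-2m configurations every A_σ = {good i : σ + ν(i) − n²d ∈ B},
-- σ < 2n²d, is free of degree-m configurations, and averaging over σ yields
-- r_m(k, N) ≥ (Q+1)^d r_2m(k, n²d) / (2n²d).
module Submission where

open import Defs
open import Data.Nat using (ℕ; NonZero)

module Polynomial where

  open import Data.Integer
    using (ℤ; +_; _+_; _*_; _-_; -_; ∣_∣; 0ℤ)
  open import Data.Integer.Properties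
    using (+-0-abelianGroup; *-comm; *-zeroʳ; +-identityˡ; +-identityʳ; *-distribˡ-+; abs-*;
           ∣i∣≡0⇒i≡0; ∣-i∣≡∣i∣; ∣i-j∣≤∣i∣+∣j∣; _≟_)
  open import Data.Integer.Tactic.RingSolver using (solve-∀)
  open import Algebra.Properties.AbelianGroup +-0-abelianGroup using () renaming (∙-cancelˡ to +-cancelˡ-≡)
  open import Data.Nat as ℕ using (ℕ; zero; suc; _≤′_; ≤′-refl; ≤′-step)
  import Data.Nat.Properties as ℕ
  open import Data.Fin using (Fin; zero; suc)
  open import Data.Fin.Properties using (¬∀⟶∃¬)
  open import Data.Product using (Σ; ∃; _×_; _,_; proj₁; proj₂)
  open import Data.Empty using (⊥-elim)
  open import Function using (_∘_)
  open import Relation.Nullary using (yes; no)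
  open import Relation.Binary.PropositionalEquality hiding (J)

  Poly≤ : ℕ → (ℤ → ℤ) → Set
  Poly≤ e f = Σ ℤ λ x → Σ (Fin e → ℤ) λ a → ∀ J → f J ≡ x + polySum e a J

  polySum-suc : ∀ e (a : Fin (suc e) → ℤ) J →
                polySum (suc e) a J ≡ J * (a zero + polySum e (a ∘ suc) J)
  polySum-suc e a J = lemma (a zero) (polySum e (a ∘ suc) J) J
    where lemma : ∀ a₀ p J → a₀ * (J * + 1) + p * J ≡ J * (a₀ + p)
          lemma = solve-∀

  polySum-zeros : ∀ e (a : Fin e → ℤ) J → (∀ i → a i ≡ 0ℤ) → polySum e a J ≡ 0ℤ
  polySum-zeros zero    a J _  = refl
  polySum-zeros (suc e) a J a≡0 = begin
    polySum (suc e) a J                  ≡⟨ polySum-suc e a J ⟩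
    J * (a zero + polySum e (a ∘ suc) J) ≡⟨ cong₂ (λ u v → J * (u + v)) (a≡0 zero) (polySum-zeros e (a ∘ suc) J (a≡0 ∘ suc)) ⟩
    J * 0ℤ                               ≡⟨ *-zeroʳ J ⟩
    0ℤ                                   ∎
    where open ≡-Reasoning

  polySum-at-0 : ∀ e (a : Fin e → ℤ) → polySum e a 0ℤ ≡ 0ℤ
  polySum-at-0 zero    a = refl
  polySum-at-0 (suc e) a = polySum-suc e a 0ℤ

  polySum-+ : ∀ e (a b : Fin e → ℤ) J →
              polySum e (λ i → a i + b i) J ≡ polySum e a J + polySum e b J
  polySum-+ zero    a b J = refl
  polySum-+ (suc e) a b J
    rewrite polySum-suc e (λ i → a i + b i) J | polySum-suc e a J | polySum-suc e b J
          | polySum-+ e (a ∘ suc) (b ∘ suc) J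
    = lemma (a zero) (b zero) (polySum e (a ∘ suc) J) (polySum e (b ∘ suc) J) J
    where lemma : ∀ a₀ b₀ p q J → J * (a₀ + b₀ + (p + q)) ≡ J * (a₀ + p) + J * (b₀ + q)
          lemma = solve-∀

  polySum-* : ∀ e (a : Fin e → ℤ) s J → polySum e (λ i → s * a i) J ≡ s * polySum e a J
  polySum-* zero    a s J = sym (*-zeroʳ s)
  polySum-* (suc e) a s J
    rewrite polySum-suc e (λ i → s * a i) J | polySum-suc e a J | polySum-* e (a ∘ suc) s J
    = lemma (a zero) (polySum e (a ∘ suc) J) s J
    where lemma : ∀ a₀ p s J → J * (s * a₀ + s * p) ≡ s * (J * (a₀ + p))
          lemma = solve-∀

  Poly≤-cong : ∀ {e f g} → Poly≤ e f → f ≗ g → Poly≤ e g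
  Poly≤-cong (x , a , f≡) f≗g = x , a , λ J → trans (sym (f≗g J)) (f≡ J)

  Poly≤-const : ∀ e c → Poly≤ e (λ _ → c)
  Poly≤-const e c = c , (λ _ → 0ℤ) , λ J →
    sym (trans (cong (_+_ c) (polySum-zeros e _ J (λ _ → refl))) (+-identityʳ c))

  Poly≤-+ : ∀ {e f g} → Poly≤ e f → Poly≤ e g → Poly≤ e (λ J → f J + g J)
  Poly≤-+ {e} (x , a , f≡) (y , b , g≡) = x + y , (λ i → a i + b i) , λ J → begin
    _                                       ≡⟨ cong₂ _+_ (f≡ J) (g≡ J) ⟩
    x + polySum e a J + (y + polySum e b J) ≡⟨ lemma x y (polySum e a J) (polySum e b J) ⟩
    x + y + (polySum e a J + polySum e b J) ≡⟨ cong (_+_ (x + y)) (polySum-+ e a b J) ⟨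
    x + y + polySum e (λ i → a i + b i) J   ∎
    where open ≡-Reasoning
          lemma : ∀ x y p q → x + p + (y + q) ≡ x + y + (p + q)
          lemma = solve-∀

  Poly≤-scale : ∀ {e f} → Poly≤ e f → ∀ s → Poly≤ e (λ J → s * f J)
  Poly≤-scale {e} (x , a , f≡) s = s * x , (λ i → s * a i) , λ J → begin
    _                           ≡⟨ cong (s *_) (f≡ J) ⟩
    s * (x + polySum e a J)     ≡⟨ *-distribˡ-+ s x _ ⟩
    s * x + s * polySum e a J   ≡⟨ cong (_+_ (s * x)) (polySum-* e a s J) ⟨
    s * x + polySum e (λ i → s * a i) J ∎
    where open ≡-Reasoning

  Poly≤-horner : ∀ {e h} → Poly≤ e h → ∀ c → Poly≤ (suc e) (λ J → c + J * h J)
  Poly≤-horner {e} (x , a , h≡) c = c , coeffs , λ J →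
    cong (_+_ c) (trans (cong (J *_) (h≡ J)) (sym (polySum-suc e coeffs J)))
    where coeffs : Fin (suc e) → ℤ
          coeffs zero    = x
          coeffs (suc i) = a i

  Poly≤-horner⁻¹ : ∀ {e f} → Poly≤ (suc e) f →
                   Σ ℤ λ c → Σ (ℤ → ℤ) λ h → Poly≤ e h × (∀ J → f J ≡ c + J * h J)
  Poly≤-horner⁻¹ {e} (x , a , f≡) =
    x , (λ J → a zero + polySum e (a ∘ suc) J) , (a zero , a ∘ suc , λ _ → refl) ,
    λ J → trans (f≡ J) (cong (_+_ x) (polySum-suc e a J))

  Poly≤-suc : ∀ {e f} → Poly≤ e f → Poly≤ (suc e) f
  Poly≤-suc {zero}  (x , a , f≡) = Poly≤-cong (Poly≤-horner (Poly≤-const zero 0ℤ) x) λ J →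
    trans (cong (_+_ x) (*-zeroʳ J)) (sym (f≡ J))
  Poly≤-suc {suc e} p with Poly≤-horner⁻¹ p
  ... | c , h , h-poly , f≡ = Poly≤-cong (Poly≤-horner (Poly≤-suc h-poly) c) (sym ∘ f≡)

  Poly≤-mono : ∀ {e e′ f} → e ≤′ e′ → Poly≤ e f → Poly≤ e′ f
  Poly≤-mono ≤′-refl        p = p
  Poly≤-mono (≤′-step e≤e′) p = Poly≤-suc (Poly≤-mono e≤e′ p)

  Poly≤-* : ∀ {e e′ f g} → Poly≤ e f → Poly≤ e′ g → Poly≤ (e ℕ.+ e′) (λ J → f J * g J)
  Poly≤-* {zero} {e′} {f} {g} (x , a , f≡) q = Poly≤-cong (Poly≤-scale q x) λ J →
    cong (_* g J) (sym (trans (f≡ J) (+-identityʳ x)))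
  Poly≤-* {suc e} {e′} {f} {g} p q with Poly≤-horner⁻¹ p
  ... | c , h , h-poly , f≡ =
    Poly≤-cong (Poly≤-+ (Poly≤-horner (Poly≤-* h-poly q) 0ℤ)
                        (Poly≤-mono (ℕ.≤⇒≤′ (ℕ.m≤n+m e′ (suc e))) (Poly≤-scale q c)))
               λ J → trans (lemma c J (h J) (g J)) (cong (_* g J) (sym (f≡ J)))
    where lemma : ∀ c J h g → 0ℤ + J * (h * g) + c * g ≡ (c + J * h) * g
          lemma = solve-∀

  Poly≤0⇒constant : ∀ {f} → Poly≤ 0 f → ∀ J J′ → f J ≡ f J′
  Poly≤0⇒constant (x , a , f≡) J J′ = trans (f≡ J) (sym (f≡ J′))

  Poly≤-factorAt : ∀ {e f} → Poly≤ (suc e) f → ∀ r →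
                   Σ (ℤ → ℤ) λ h → Poly≤ e h × (∀ J → f J ≡ f r + (J - r) * h J)
  Poly≤-factorAt {zero} {f} p r with Poly≤-horner⁻¹ p
  ... | c , h , h-poly , f≡ = h , h-poly , λ J → begin
    f J                          ≡⟨ f≡ J ⟩
    c + J * h J                  ≡⟨ lemma c J r (h J) ⟩
    c + r * h J + (J - r) * h J  ≡⟨ cong (λ u → c + r * u + (J - r) * h J) (Poly≤0⇒constant h-poly J r) ⟩
    c + r * h r + (J - r) * h J  ≡⟨ cong (λ u → u + (J - r) * h J) (f≡ r) ⟨
    f r + (J - r) * h J          ∎
    where open ≡-Reasoning
          lemma : ∀ c J r h → c + J * h ≡ c + r * h + (J - r) * h
          lemma = solve-∀
  Poly≤-factorAt {suc e} {f} p r with Poly≤-horner⁻¹ p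
  ... | c , h , h-poly , f≡ with Poly≤-factorAt h-poly r
  ... | h₂ , h₂-poly , h≡ = (λ J → h r + J * h₂ J) , Poly≤-horner h₂-poly (h r) , λ J → begin
    f J                                       ≡⟨ f≡ J ⟩
    c + J * h J                               ≡⟨ cong (λ u → c + J * u) (h≡ J) ⟩
    c + J * (h r + (J - r) * h₂ J)            ≡⟨ lemma c J r (h r) (h₂ J) ⟩
    c + r * h r + (J - r) * (h r + J * h₂ J)  ≡⟨ cong (λ u → u + (J - r) * (h r + J * h₂ J)) (f≡ r) ⟨
    f r + (J - r) * (h r + J * h₂ J)          ∎
    where open ≡-Reasoning
          lemma : ∀ c J r h₀ h₂ → c + J * (h₀ + (J - r) * h₂) ≡ c + r * h₀ + (J - r) * (h₀ + J * h₂)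
          lemma = solve-∀

  Poly≤-unfactorAt : ∀ {e h} → Poly≤ e h → ∀ c r → Poly≤ (suc e) (λ J → c + (J - r) * h J)
  Poly≤-unfactorAt {e} {h} p c r =
    Poly≤-cong (Poly≤-+ (Poly≤-horner p c) (Poly≤-suc (Poly≤-scale p (- r)))) λ J → lemma c J r (h J)
    where lemma : ∀ c J r h → c + J * h + - r * h ≡ c + (J - r) * h
          lemma = solve-∀

  ∣i∣≤∣i*j∣ : ∀ i {j} → j ≢ 0ℤ → ∣ i ∣ ℕ.≤ ∣ i * j ∣
  ∣i∣≤∣i*j∣ i {j} j≢0 = subst (∣ i ∣ ℕ.≤_) (sym (abs-* i j))
    (ℕ.m≤m*n ∣ i ∣ ∣ j ∣ {{ℕ.≢-nonZero (j≢0 ∘ ∣i∣≡0⇒i≡0)}})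

  ∣j∣≤∣i*j∣ : ∀ {i} j → i ≢ 0ℤ → ∣ j ∣ ℕ.≤ ∣ i * j ∣
  ∣j∣≤∣i*j∣ {i} j i≢0 = subst (∣ j ∣ ℕ.≤_) (cong ∣_∣ (*-comm j i)) (∣i∣≤∣i*j∣ j i≢0)

  a≡b+i*j⇒∣j∣≤∣a∣+∣b∣ : ∀ {a b i j} → i ≢ 0ℤ → a ≡ b + i * j → ∣ j ∣ ℕ.≤ ∣ a ∣ ℕ.+ ∣ b ∣
  a≡b+i*j⇒∣j∣≤∣a∣+∣b∣ {a} {b} {i} {j} i≢0 a≡b+ij = ℕ.≤-trans (∣j∣≤∣i*j∣ j i≢0)
    (subst (λ x → ∣ x ∣ ℕ.≤ ∣ a ∣ ℕ.+ ∣ b ∣) a-b≡ij (∣i-j∣≤∣i∣+∣j∣ a b))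
    where a-b≡ij : a - b ≡ i * j
          a-b≡ij = trans (cong (_- b) a≡b+ij) (lemma b (i * j))
            where lemma : ∀ b x → b + x - b ≡ x
                  lemma = solve-∀

  polySum-multiple : ∀ e (a : Fin e → ℤ) J → Σ ℤ λ s → polySum e a J ≡ J * s
  polySum-multiple zero    a J = 0ℤ , sym (*-zeroʳ J)
  polySum-multiple (suc e) a J = _ , polySum-suc e a J

  -- |J s| ≥ |J| > |b| unless s = 0
  b+J*s≢0 : ∀ {b} J s → b ≢ 0ℤ → ∣ b ∣ ℕ.< ∣ J ∣ → b + J * s ≢ 0ℤ
  b+J*s≢0 {b} J s b≢0 ∣b∣<∣J∣ b+Js≡0 with s ≟ 0ℤ
  ... | yes refl = b≢0 (trans (sym (trans (cong (_+_ b) (*-zeroʳ J)) (+-identityʳ b))) b+Js≡0)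
  ... | no  s≢0  = ℕ.<⇒≱ ∣b∣<∣J∣ (subst (∣ J ∣ ℕ.≤_) ∣Js∣≡∣b∣ (∣i∣≤∣i*j∣ J s≢0))
    where
    b≡-Js : b ≡ - (J * s)
    b≡-Js = trans (lemma b (J * s)) (trans (cong (_+_ (- (J * s))) b+Js≡0) (+-identityʳ _))
      where lemma : ∀ b x → b ≡ - x + (b + x)
            lemma = solve-∀
    ∣Js∣≡∣b∣ : ∣ J * s ∣ ≡ ∣ b ∣
    ∣Js∣≡∣b∣ = trans (sym (∣-i∣≡∣i∣ (J * s))) (cong ∣_∣ (sym b≡-Js))

  polySum-unbounded : ∀ e (a : Fin e → ℤ) i → a i ≢ 0ℤ → ∀ M → ∃ λ J → M ℕ.< ∣ polySum e a J ∣
  polySum-unbounded (suc e) a i aᵢ≢0 M with a zero ≟ 0ℤ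
  ... | no a₀≢0 = J , subst (λ u → M ℕ.< ∣ u ∣) (sym (polySum-suc e a J)) M<∣Jw∣
    where
    -- Horner form J (a₀ + J s) with |J| > |a₀|: the bracket cannot vanish
    J = + suc (M ℕ.+ ∣ a zero ∣)
    s = proj₁ (polySum-multiple e (a ∘ suc) J)
    w≢0 : a zero + polySum e (a ∘ suc) J ≢ 0ℤ
    w≢0 = subst (_≢ 0ℤ) (cong (_+_ (a zero)) (sym (proj₂ (polySum-multiple e (a ∘ suc) J))))
                (b+J*s≢0 J s a₀≢0 (ℕ.s≤s (ℕ.m≤n+m _ M)))
    M<∣Jw∣ : M ℕ.< ∣ J * (a zero + polySum e (a ∘ suc) J) ∣
    M<∣Jw∣ = ℕ.<-≤-trans (ℕ.s≤s (ℕ.m≤m+n M _)) (∣i∣≤∣i*j∣ J w≢0)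
  polySum-unbounded (suc e) a zero    a₀≢0 M | yes a₀≡0 = ⊥-elim (a₀≢0 a₀≡0)
  polySum-unbounded (suc e) a (suc i) aᵢ≢0 M | yes a₀≡0
    with polySum-unbounded e (a ∘ suc) i aᵢ≢0 M
  ... | J , M<∣p∣ = J , subst (λ u → M ℕ.< ∣ u ∣) (sym p≡) (ℕ.<-≤-trans M<∣p∣ (∣j∣≤∣i*j∣ p J≢0))
    where
    p = polySum e (a ∘ suc) J
    p≡ : polySum (suc e) a J ≡ J * p
    p≡ = trans (polySum-suc e a J) (trans (cong (λ u → J * (u + p)) a₀≡0) (cong (J *_) (+-identityˡ p)))
    J≢0 : J ≢ 0ℤ
    J≢0 J≡0 = ℕ.<⇒≱ M<∣p∣ (ℕ.≤-trans (ℕ.≤-reflexive ∣p∣≡0) ℕ.z≤n)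
      where ∣p∣≡0 : ∣ p ∣ ≡ 0
            ∣p∣≡0 = cong ∣_∣ (trans (cong (polySum e (a ∘ suc)) J≡0) (polySum-at-0 e (a ∘ suc)))

  module _ {e} {f : ℤ → ℤ} (x : ℤ) (a : Fin e → ℤ) (f≡ : ∀ J → f J ≡ x + polySum e a J) where

    nonconstant⇒coeff≢0 : ∀ J → f J ≢ f 0ℤ → ∃ λ i → a i ≢ 0ℤ
    nonconstant⇒coeff≢0 J fJ≢f0 = ¬∀⟶∃¬ e _ (λ i → a i ≟ 0ℤ) λ a≡0 → fJ≢f0 (begin
      f J                 ≡⟨ f≡ J ⟩
      x + polySum e a J   ≡⟨ cong (_+_ x) (polySum-zeros e a J a≡0) ⟩
      x + 0ℤ              ≡⟨ cong (_+_ x) (polySum-at-0 e a) ⟨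
      x + polySum e a 0ℤ  ≡⟨ f≡ 0ℤ ⟨
      f 0ℤ                ∎)
      where open ≡-Reasoning

    coeff≢0⇒nonconstant : ∀ i → a i ≢ 0ℤ → ∃ λ J → f J ≢ f 0ℤ
    coeff≢0⇒nonconstant i aᵢ≢0 with polySum-unbounded e a i aᵢ≢0 0
    ... | J , 0<∣p∣ = J , λ fJ≡f0 → ℕ.<⇒≢ 0<∣p∣ (sym (cong ∣_∣ (p≡0 fJ≡f0)))
      where
      p≡0 : f J ≡ f 0ℤ → polySum e a J ≡ 0ℤ
      p≡0 fJ≡f0 = +-cancelˡ-≡ x _ _ (begin
        x + polySum e a J  ≡⟨ f≡ J ⟨
        f J                ≡⟨ fJ≡f0 ⟩
        f 0ℤ               ≡⟨ f≡ 0ℤ ⟩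
        x + polySum e a 0ℤ ≡⟨ cong (_+_ x) (polySum-at-0 e a) ⟩
        x + 0ℤ             ∎)
        where open ≡-Reasoning

  Poly≤-unbounded : ∀ {e f} → Poly≤ e f → ∀ {J₁} → f J₁ ≢ f 0ℤ → ∀ M → ∃ λ J → M ℕ.< ∣ f J ∣
  Poly≤-unbounded {e} {f} (x , a , f≡) fJ₁≢f0 M
    with nonconstant⇒coeff≢0 x a f≡ _ fJ₁≢f0
  ... | i , aᵢ≢0 with polySum-unbounded e a i aᵢ≢0 (M ℕ.+ ∣ x ∣)
  ... | J , M+∣x∣<∣p∣ = J , ℕ.+-cancelʳ-< (∣ x ∣) M (∣ f J ∣) (ℕ.<-≤-trans M+∣x∣<∣p∣ ∣p∣≤∣fJ∣+∣x∣)
    where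
    ∣p∣≤∣fJ∣+∣x∣ : ∣ polySum e a J ∣ ℕ.≤ ∣ f J ∣ ℕ.+ ∣ x ∣
    ∣p∣≤∣fJ∣+∣x∣ = subst (λ u → ∣ u ∣ ℕ.≤ ∣ f J ∣ ℕ.+ ∣ x ∣) p≡fJ-x (∣i-j∣≤∣i∣+∣j∣ (f J) x)
      where p≡fJ-x : f J - x ≡ polySum e a J
            p≡fJ-x = trans (cong (_- x) (f≡ J)) (lemma x (polySum e a J))
              where lemma : ∀ x p → x + p - x ≡ p
                    lemma = solve-∀

module BaseExpansion (n : ℕ) where

  open Polynomial
  open import Data.Integer
    using (ℤ; +_; _+_; _*_; _-_; -_; ∣_∣; 0ℤ; -1ℤ)
  open import Data.Integer.Properties
    using (+-0-abelianGroup; *-zeroʳ; *-zeroˡ; +-identityʳ; abs-*; ∣i∣≡0⇒i≡0; ∣-i∣≡∣i∣;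
           ∣i-j∣≤∣i∣+∣j∣; pos-+; pos-*; *-cancelˡ-≡)
  open import Algebra.Properties.AbelianGroup +-0-abelianGroup using () renaming (∙-cancelˡ to +-cancelˡ-≡)
  open import Data.Integer.Tactic.RingSolver using (solve-∀)
  open import Data.Nat.Tactic.RingSolver using () renaming (solve-∀ to ℕ-solve-∀)
  open import Data.Nat as ℕ using (ℕ; zero; suc; _≤_; _<_; _^_; s≤s; z≤n)
  import Data.Nat.Properties as ℕ
  open import Data.Nat.Divisibility using (_∣_)
  open import Data.Fin using (Fin; zero; suc; toℕ)
  open import Data.Fin.Properties using (toℕ<n)
  open import Data.Product using (proj₁; proj₂)
  open import Data.Empty using (⊥-elim)
  open import Function using (_∘_)
  open import Relation.Binary.PropositionalEquality hiding (J)

  m*n<m⇒n≡0 : ∀ m n → m ℕ.* n ℕ.< m → n ≡ 0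
  m*n<m⇒n≡0 m zero    _  = refl
  m*n<m⇒n≡0 m (suc n) lt = ⊥-elim (ℕ.<⇒≱ lt (ℕ.m≤m*n m (suc n)))

  value : ∀ d → (Fin d → ℤ) → ℤ
  value zero    u = 0ℤ
  value (suc d) u = u zero + + n * value d (u ∘ suc)

  value-cong : ∀ d {u v : Fin d → ℤ} → u ≗ v → value d u ≡ value d v
  value-cong zero    u≗v = refl
  value-cong (suc d) u≗v = cong₂ (λ a b → a + + n * b) (u≗v zero) (value-cong d (u≗v ∘ suc))

  value-+-* : ∀ d (u v : Fin d → ℤ) c → value d (λ t → u t + c * v t) ≡ value d u + c * value d v
  value-+-* zero    u v c = sym (cong (_+_ 0ℤ) (*-zeroʳ c))
  value-+-* (suc d) u v c rewrite value-+-* d (u ∘ suc) (v ∘ suc) c =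
    lemma (u zero) (v zero) c (+ n) (value d (u ∘ suc)) (value d (v ∘ suc))
    where lemma : ∀ u₀ v₀ c n U V → u₀ + c * v₀ + n * (U + c * V) ≡ u₀ + n * U + c * (v₀ + n * V)
          lemma = solve-∀

  value≡0⇒digits≡0 : ∀ d (w : Fin d → ℤ) → value d w ≡ 0ℤ → (∀ t → ∣ w t ∣ < n) → ∀ t → w t ≡ 0ℤ
  value≡0⇒digits≡0 (suc d) w value≡0 ∣w∣<n = digits≡0
    where
    W = value d (w ∘ suc)
    w₀≡-nW : w zero ≡ - (+ n * W)
    w₀≡-nW = trans (lemma (w zero) (+ n * W)) (trans (cong (_+_ (- (+ n * W))) value≡0) (+-identityʳ _))
      where lemma : ∀ a b → a ≡ - b + (a + b)
            lemma = solve-∀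
    W≡0 : W ≡ 0ℤ
    W≡0 = ∣i∣≡0⇒i≡0 (m*n<m⇒n≡0 n ∣ W ∣ (subst (_< n) ∣w₀∣≡n∣W∣ (∣w∣<n zero)))
      where ∣w₀∣≡n∣W∣ : ∣ w zero ∣ ≡ n ℕ.* ∣ W ∣
            ∣w₀∣≡n∣W∣ = trans (cong ∣_∣ w₀≡-nW) (trans (∣-i∣≡∣i∣ (+ n * W)) (abs-* (+ n) W))
    digits≡0 : ∀ t → w t ≡ 0ℤ
    digits≡0 zero    = trans w₀≡-nW (trans (cong (λ x → - (+ n * x)) W≡0) (cong -_ (*-zeroʳ (+ n))))
    digits≡0 (suc t) = value≡0⇒digits≡0 d (w ∘ suc) W≡0 (∣w∣<n ∘ suc) t

  value-injective : ∀ d (u v : Fin d → ℤ) → value d u ≡ value d v → (∀ t → ∣ u t - v t ∣ < n) → u ≗ v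
  value-injective d u v u≡v ∣u-v∣<n t = begin
    u t            ≡⟨ lemma (u t) (v t) ⟩
    v t + diff t   ≡⟨ cong (_+_ (v t)) (value≡0⇒digits≡0 d diff value-diff≡0 ∣diff∣<n t) ⟩
    v t + 0ℤ       ≡⟨ +-identityʳ (v t) ⟩
    v t            ∎
    where
    open ≡-Reasoning
    diff : Fin d → ℤ
    diff t = u t + -1ℤ * v t
    lemma : ∀ a b → a ≡ b + (a + -1ℤ * b)
    lemma = solve-∀
    ∣diff∣<n : ∀ t → ∣ diff t ∣ < n
    ∣diff∣<n t = subst (λ x → ∣ x ∣ < n) (lemma′ (u t) (v t)) (∣u-v∣<n t)
      where lemma′ : ∀ a b → a - b ≡ a + -1ℤ * b
            lemma′ = solve-∀
    value-diff≡0 : value d diff ≡ 0ℤ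
    value-diff≡0 = trans (value-+-* d u v -1ℤ) (trans (cong (λ x → x + -1ℤ * value d v) u≡v) (lemma″ (value d v)))
      where lemma″ : ∀ x → x + -1ℤ * x ≡ 0ℤ
            lemma″ = solve-∀

  node : ∀ {K} → ℕ → Fin K → ℤ
  node o s = + (o ℕ.+ toℕ s)

  node-offset : ∀ {K} o (s : Fin K) → node o s - + o ≡ + toℕ s
  node-offset o s = trans (cong (_- + o) (pos-+ o (toℕ s))) (lemma (+ o) (+ toℕ s))
    where lemma : ∀ a b → a + b - a ≡ b
          lemma = solve-∀

  node-zero : ∀ {K} o → node {suc K} o zero ≡ + o
  node-zero o = cong +_ (ℕ.+-identityʳ o)

  node-suc : ∀ {K} o (s : Fin K) → node (suc o) s ≡ node o (suc s)
  node-suc o s = cong +_ (sym (ℕ.+-suc o (toℕ s)))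

  record Digitwise e d {K} (o : ℕ) (g : ℤ → ℤ) (u : Fin K → Fin d → ℤ) : Set where
    field
      digitPoly      : Fin d → ℤ → ℤ
      digitPoly-poly : ∀ t → Poly≤ e (digitPoly t)
      digitPoly-node : ∀ s t → digitPoly t (node o s) ≡ u s t
      g≡value        : ∀ J → g J ≡ value d (λ t → digitPoly t J)

  F^e-dividedDifference : ∀ {F δ ρ} e → F ≡ ρ ℕ.* δ → ∀ z₀ z →
    + (F ^ suc e) * z ≡ + (F ^ suc e) * z₀ + + δ * (+ (F ^ e) * (+ ρ * (z - z₀)))
  F^e-dividedDifference {F} {δ} {ρ} e F≡ρδ z₀ z = begin
    + (F ℕ.* F ^ e) * z                     ≡⟨ cong (_* z) +F^1+e≡ ⟩
    + ρ * + δ * + (F ^ e) * z               ≡⟨ lemma (+ ρ) (+ δ) (+ (F ^ e)) z₀ z ⟩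
    + ρ * + δ * + (F ^ e) * z₀ + difference ≡⟨ cong (λ c → c * z₀ + difference) +F^1+e≡ ⟨
    + (F ℕ.* F ^ e) * z₀ + difference       ∎
    where
    open ≡-Reasoning
    difference = + δ * (+ (F ^ e) * (+ ρ * (z - z₀)))
    +F^1+e≡ : + (F ℕ.* F ^ e) ≡ + ρ * + δ * + (F ^ e)
    +F^1+e≡ = trans (pos-* F (F ^ e)) (cong (_* + (F ^ e)) (trans (cong +_ F≡ρδ) (pos-* ρ δ)))
    lemma : ∀ r d f z₀ z → r * d * f * z ≡ r * d * f * z₀ + d * (f * (r * (z - z₀)))
    lemma = solve-∀

  Digitwise-unfactorAt : ∀ {e d K o g h} (u : Fin (suc K) → Fin d → ℤ) (u′ : Fin K → Fin d → ℤ) →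
    (∀ s t → u (suc s) t ≡ u zero t + + suc (toℕ s) * u′ s t) →
    (∀ J → g J ≡ value d (u zero) + (J - + o) * h J) →
    Digitwise e d (suc o) h u′ → Digitwise (suc e) d o g u
  Digitwise-unfactorAt {e} {d} {K} {o} {g} {h} u u′ u-step g≡ IH = record
    { digitPoly      = B
    ; digitPoly-poly = λ t → Poly≤-unfactorAt (IH.digitPoly-poly t) (u zero t) (+ o)
    ; digitPoly-node = B-node
    ; g≡value        = g≡value
    }
    where
    module IH = Digitwise IH
    open ≡-Reasoning
    B : Fin d → ℤ → ℤ
    B t J = u zero t + (J - + o) * IH.digitPoly t J
    B-node : ∀ s t → B t (node o s) ≡ u s t
    B-node zero t = begin
      u zero t + (J₀ - + o) * IH.digitPoly t J₀ ≡⟨ cong (λ c → u zero t + c * IH.digitPoly t J₀) (node-offset {suc K} o zero) ⟩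
      u zero t + 0ℤ * IH.digitPoly t J₀                  ≡⟨ cong (_+_ (u zero t)) (*-zeroˡ (IH.digitPoly t J₀)) ⟩
      u zero t + 0ℤ                                      ≡⟨ +-identityʳ (u zero t) ⟩
      u zero t                                           ∎
      where J₀ = node {suc K} o zero
    B-node (suc s) t = begin
      u zero t + (node o (suc s) - + o) * IH.digitPoly t (node o (suc s))
        ≡⟨ cong₂ (λ c J → u zero t + c * IH.digitPoly t J) (node-offset o (suc s)) (sym (node-suc o s)) ⟩
      u zero t + + suc (toℕ s) * IH.digitPoly t (node (suc o) s)
        ≡⟨ cong (λ c → u zero t + + suc (toℕ s) * c) (IH.digitPoly-node s t) ⟩
      u zero t + + suc (toℕ s) * u′ s t
        ≡⟨ u-step s t ⟨
      u (suc s) t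
        ∎
    g≡value : ∀ J → g J ≡ value d (λ t → B t J)
    g≡value J = begin
      g J
        ≡⟨ g≡ J ⟩
      value d (u zero) + (J - + o) * h J
        ≡⟨ cong (λ c → value d (u zero) + (J - + o) * c) (IH.g≡value J) ⟩
      value d (u zero) + (J - + o) * value d (λ t → IH.digitPoly t J)
        ≡⟨ value-+-* d (u zero) _ (J - + o) ⟨
      value d (λ t → B t J)
        ∎

  module _ (F : ℕ) where

    -- Newton interpolation digit by digit: divided differences of the digits are again digits
    -- (integral because the node gaps divide F, small because 2^(e+1) Bd < n).
    digitwise : ∀ e {K} o {Bd} d {g} (z : Fin K → Fin d → ℤ) →
                e < K → (∀ δ → 1 ≤ δ → δ < K → δ ∣ F) → 2 ^ suc e ℕ.* Bd < n →
                Poly≤ e g →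
                (∀ s t → ∣ + (F ^ e) * z s t ∣ ≤ Bd) →
                (∀ s → g (node o s) ≡ value d (λ t → + (F ^ e) * z s t)) →
                Digitwise e d o g (λ s t → + (F ^ e) * z s t)
    digitwise zero {suc K} o {Bd} d {g} z _ _ 2Bd<n g-poly ∣u∣≤Bd g-node = record
      { digitPoly      = λ t _ → u zero t
      ; digitPoly-poly = λ t → Poly≤-const 0 (u zero t)
      ; digitPoly-node = λ s → value-injective d (u zero) (u s) (value-u₀≡value-u s) (∣u₀-u∣<n s)
      ; g≡value        = λ J → trans (Poly≤0⇒constant g-poly J _) (g-node zero)
      }
      where
      u = λ s t → + 1 * z s t
      value-u₀≡value-u : ∀ s → value d (u zero) ≡ value d (u s)
      value-u₀≡value-u s = trans (sym (g-node zero)) (trans (Poly≤0⇒constant g-poly _ _) (g-node s))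
      ∣u₀-u∣<n : ∀ s t → ∣ u zero t - u s t ∣ < n
      ∣u₀-u∣<n s t = ℕ.≤-<-trans (∣i-j∣≤∣i∣+∣j∣ (u zero t) (u s t))
        (ℕ.≤-<-trans (ℕ.+-mono-≤ (∣u∣≤Bd zero t) (∣u∣≤Bd s t))
          (subst (_< n) (cong (Bd ℕ.+_) (ℕ.+-identityʳ Bd)) 2Bd<n))
    digitwise (suc e) {suc K} o {Bd} d {g} z (s≤s e<K) divF 2²⁺ᵉBd<n g-poly ∣u∣≤Bd g-node =
      Digitwise-unfactorAt u u′ u-step g≡ IH
      where
      u = λ s t → + (F ^ suc e) * z s t
      δ : Fin K → ℕ
      δ s = suc (toℕ s)
      δ∣F : ∀ s → δ s ∣ F
      δ∣F s = divF (δ s) (s≤s z≤n) (s≤s (toℕ<n s))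
      z′ : Fin K → Fin d → ℤ
      z′ s t = + _∣_.quotient (δ∣F s) * (z (suc s) t - z zero t)
      u′ = λ s t → + (F ^ e) * z′ s t
      u-step : ∀ s t → u (suc s) t ≡ u zero t + + δ s * u′ s t
      u-step s t = F^e-dividedDifference {F} {δ s} {_∣_.quotient (δ∣F s)} e (_∣_.equality (δ∣F s))
                                         (z zero t) (z (suc s) t)
      ∣u′∣≤2Bd : ∀ s t → ∣ u′ s t ∣ ≤ Bd ℕ.+ Bd
      ∣u′∣≤2Bd s t = ℕ.≤-trans (a≡b+i*j⇒∣j∣≤∣a∣+∣b∣ {b = u zero t} {+ δ s} {u′ s t} (λ ()) (u-step s t))
                               (ℕ.+-mono-≤ (∣u∣≤Bd (suc s) t) (∣u∣≤Bd zero t))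
      factored = Poly≤-factorAt g-poly (+ o)
      h = proj₁ factored
      g≡ : ∀ J → g J ≡ value d (u zero) + (J - + o) * h J
      g≡ J = trans (proj₂ (proj₂ factored) J) (cong (λ c → c + (J - + o) * h J) g[o]≡)
        where g[o]≡ : g (+ o) ≡ value d (u zero)
              g[o]≡ = trans (cong g (sym (node-zero {K} o))) (g-node zero)
      h-node : ∀ s → h (node (suc o) s) ≡ value d (u′ s)
      h-node s = *-cancelˡ-≡ (+ δ s) _ _ (+-cancelˡ-≡ (value d (u zero)) _ _ (begin
        value d (u zero) + + δ s * h (node (suc o) s)
          ≡⟨ cong₂ (λ c J → value d (u zero) + c * h J) (node-offset o (suc s)) (sym (node-suc o s)) ⟨
        value d (u zero) + (node o (suc s) - + o) * h (node o (suc s))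
          ≡⟨ g≡ (node o (suc s)) ⟨
        g (node o (suc s))
          ≡⟨ g-node (suc s) ⟩
        value d (u (suc s))
          ≡⟨ value-cong d (u-step s) ⟩
        value d (λ t → u zero t + + δ s * u′ s t)
          ≡⟨ value-+-* d (u zero) (u′ s) (+ δ s) ⟩
        value d (u zero) + + δ s * value d (u′ s)
          ∎))
        where open ≡-Reasoning
      2¹⁺ᵉ2Bd<n : 2 ^ suc e ℕ.* (Bd ℕ.+ Bd) < n
      2¹⁺ᵉ2Bd<n = subst (_< n) (lemma (2 ^ suc e) Bd) 2²⁺ᵉBd<n
        where lemma : ∀ x b → 2 ℕ.* x ℕ.* b ≡ x ℕ.* (b ℕ.+ b)
              lemma = ℕ-solve-∀
      IH = digitwise e (suc o) d z′ e<K (λ δ 1≤δ δ<K → divF δ 1≤δ (ℕ.m<n⇒m<1+n δ<K))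
                     2¹⁺ᵉ2Bd<n (proj₁ (proj₂ factored)) ∣u′∣≤2Bd h-node

module RangeSum where

  open import Data.Nat
  open import Data.Nat.Properties
  open import Data.Nat.Tactic.RingSolver using (solve-∀)
  open import Function using (_∘_)
  open import Relation.Binary.PropositionalEquality

  ∑< : ℕ → (ℕ → ℕ) → ℕ
  ∑< zero    f = 0
  ∑< (suc M) f = f 0 + ∑< M (f ∘ suc)

  syntax ∑< M (λ i → e) = ∑[ i < M ] e

  ∑-cong : ∀ M {f g} → (∀ i → i < M → f i ≡ g i) → ∑< M f ≡ ∑< M g
  ∑-cong zero    f≡g = refl
  ∑-cong (suc M) f≡g = cong₂ _+_ (f≡g 0 z<s) (∑-cong M (λ i i<M → f≡g (suc i) (s<s i<M)))

  ∑-mono-≤ : ∀ M {f g} → (∀ i → i < M → f i ≤ g i) → ∑< M f ≤ ∑< M g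
  ∑-mono-≤ zero    f≤g = z≤n
  ∑-mono-≤ (suc M) f≤g = +-mono-≤ (f≤g 0 z<s) (∑-mono-≤ M (λ i i<M → f≤g (suc i) (s<s i<M)))

  ∑-+ : ∀ a b f → ∑< (a + b) f ≡ ∑< a f + ∑[ i < b ] f (a + i)
  ∑-+ zero    b f = refl
  ∑-+ (suc a) b f = trans (cong (f 0 +_) (∑-+ a b (f ∘ suc))) (sym (+-assoc (f 0) _ _))

  ∑-prefix : ∀ a b f → ∑< a f ≤ ∑< (a + b) f
  ∑-prefix a b f = subst (∑< a f ≤_) (sym (∑-+ a b f)) (m≤m+n _ _)

  ∑-distrib-+ : ∀ M f g → ∑[ i < M ] (f i + g i) ≡ ∑< M f + ∑< M g
  ∑-distrib-+ zero    f g = refl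
  ∑-distrib-+ (suc M) f g rewrite ∑-distrib-+ M (f ∘ suc) (g ∘ suc) = +-+-exchange (f 0) (g 0) _ _
    where +-+-exchange : ∀ a b c d → a + b + (c + d) ≡ a + c + (b + d)
          +-+-exchange = solve-∀

  ∑-zero : ∀ M → ∑[ i < M ] 0 ≡ 0
  ∑-zero zero    = refl
  ∑-zero (suc M) = ∑-zero M

  ∑-comm : ∀ a b (f : ℕ → ℕ → ℕ) → ∑[ i < a ] ∑[ j < b ] f i j ≡ ∑[ j < b ] ∑[ i < a ] f i j
  ∑-comm zero    b f = sym (∑-zero b)
  ∑-comm (suc a) b f = trans (cong (∑< b (f 0) +_) (∑-comm a b (f ∘ suc)))
                             (sym (∑-distrib-+ b (f 0) (λ j → ∑[ i < a ] f (suc i) j)))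

  ∑-*ʳ : ∀ M f c → ∑[ i < M ] (f i * c) ≡ ∑< M f * c
  ∑-*ʳ zero    f c = refl
  ∑-*ʳ (suc M) f c = trans (cong (f 0 * c +_) (∑-*ʳ M (f ∘ suc) c)) (sym (*-distribʳ-+ c (f 0) _))

  ∑-const : ∀ M c → ∑[ i < M ] c ≡ M * c
  ∑-const zero    c = refl
  ∑-const (suc M) c = cong (c +_) (∑-const M c)

  ∑-≤-* : ∀ M {f} c → (∀ i → i < M → f i ≤ c) → ∑< M f ≤ M * c
  ∑-≤-* M c f≤c = subst (_ ≤_) (∑-const M c) (∑-mono-≤ M f≤c)

  ∑-blocks : ∀ a M f → ∑< (M * a) f ≡ ∑[ y < M ] ∑[ x < a ] f (x + y * a)
  ∑-blocks a zero    f = refl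
  ∑-blocks a (suc M) f = trans (∑-+ a (M * a) f) (cong₂ _+_
    (∑-cong a (λ x _ → cong f (sym (+-identityʳ x))))
    (trans (∑-blocks a M (λ i → f (a + i))) (∑-cong M (λ y _ → ∑-cong a (λ x _ → cong f (lemma a x y))))))
    where lemma : ∀ a x y → a + (x + y * a) ≡ x + (a + y * a)
          lemma = solve-∀

  ∑-head : ∀ M f → 0 < M → f 0 ≤ ∑< M f
  ∑-head (suc M) f _ = m≤m+n (f 0) _

module SubsetCounting where

  open RangeSum
  open import Data.Nat
  open import Data.Bool using (Bool; true; false; if_then_else_; T; _∧_)
  open import Data.Nat.Properties using (+-identityʳ)
  open import Data.Bool.Properties using (T-≡)
  open import Data.Integer using (+_)
  open import Data.Fin using (Fin; toℕ) renaming (zero to fzero; suc to fsuc)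
  open import Data.Fin.Subset using (Subset; _∈_; ∣_∣)
  open import Data.Vec using (_∷_; []; tabulate; here; there)
  open import Data.Vec.Properties using ([]=⇒lookup; lookup∘tabulate)
  open import Data.Product using (_,_)
  open import Function using (_∘_; Equivalence)
  open import Relation.Binary.PropositionalEquality

  𝟙 : Bool → ℕ
  𝟙 b = if b then 1 else 0

  T⇒𝟙≡1 : ∀ {b} → T b → 𝟙 b ≡ 1
  T⇒𝟙≡1 {true} _ = refl

  𝟙-∧ : ∀ a b → 𝟙 (a ∧ b) ≡ 𝟙 a * 𝟙 b
  𝟙-∧ true  b = sym (+-identityʳ (𝟙 b))
  𝟙-∧ false b = refl

  _∋ᵇ_ : ∀ {M} → Subset M → ℕ → Bool
  []      ∋ᵇ i     = false
  (x ∷ p) ∋ᵇ zero  = x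
  (x ∷ p) ∋ᵇ suc i = p ∋ᵇ i

  ∣p∣≡∑ : ∀ {M} (p : Subset M) → ∣ p ∣ ≡ ∑[ i < M ] 𝟙 (p ∋ᵇ i)
  ∣p∣≡∑ []          = refl
  ∣p∣≡∑ (true  ∷ p) = cong suc (∣p∣≡∑ p)
  ∣p∣≡∑ (false ∷ p) = ∣p∣≡∑ p

  ∋ᵇ⇒∈ℤ : ∀ {M} (p : Subset M) i → T (p ∋ᵇ i) → (+ i) ∈ℤ p
  ∋ᵇ⇒∈ℤ (true ∷ p) zero    _  = fzero , refl , here
  ∋ᵇ⇒∈ℤ (x    ∷ p) (suc i) i∈p with ∋ᵇ⇒∈ℤ p i i∈p
  ... | f , refl , f∈p = fsuc f , refl , there f∈p

  fromBool : ∀ M → (ℕ → Bool) → Subset M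
  fromBool M b = tabulate (b ∘ toℕ)

  fromBool-∋ᵇ : ∀ M b i → i < M → fromBool M b ∋ᵇ i ≡ b i
  fromBool-∋ᵇ (suc M) b zero    _       = refl
  fromBool-∋ᵇ (suc M) b (suc i) (s<s i<M) = fromBool-∋ᵇ M (b ∘ suc) i i<M

  ∣fromBool∣ : ∀ M b → ∣ fromBool M b ∣ ≡ ∑[ i < M ] 𝟙 (b i)
  ∣fromBool∣ M b = trans (∣p∣≡∑ (fromBool M b)) (∑-cong M (λ i i<M → cong 𝟙 (fromBool-∋ᵇ M b i i<M)))

  ∈fromBool : ∀ M b (f : Fin M) → f ∈ fromBool M b → T (b (toℕ f))
  ∈fromBool M b f f∈ = Equivalence.from T-≡ (trans (sym (lookup∘tabulate (b ∘ toℕ) f)) ([]=⇒lookup f∈))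

module SumOfSquares where

  open Polynomial
  open import Data.Integer as ℤ using (ℤ; +_; -[1+_]; _+_; _*_; ∣_∣; 0ℤ)
  import Data.Integer.Properties as ℤ
  open import Data.Nat as ℕ using (ℕ; zero; suc; _≤_; _<_; _^_)
  import Data.Nat.Properties as ℕ
  open import Data.Fin using (Fin; zero; suc)
  open import Data.Product using (∃; _,_)
  open import Function using (_∘_)
  open import Relation.Binary.PropositionalEquality hiding (J)

  ∑sq : ∀ d → (Fin d → ℕ) → ℕ
  ∑sq zero    w = 0
  ∑sq (suc d) w = w zero ℕ.* w zero ℕ.+ ∑sq d (w ∘ suc)

  ∑sqℤ : ∀ d → (Fin d → ℤ) → ℤ
  ∑sqℤ zero    v = 0ℤ
  ∑sqℤ (suc d) v = v zero * v zero + ∑sqℤ d (v ∘ suc)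

  ∑sqℤ-cong : ∀ d {u v : Fin d → ℤ} → u ≗ v → ∑sqℤ d u ≡ ∑sqℤ d v
  ∑sqℤ-cong zero    u≗v = refl
  ∑sqℤ-cong (suc d) u≗v = cong₂ (λ a b → a * a + b) (u≗v zero) (∑sqℤ-cong d (u≗v ∘ suc))

  i*i≡∣i∣*∣i∣ : ∀ i → i * i ≡ + (∣ i ∣ ℕ.* ∣ i ∣)
  i*i≡∣i∣*∣i∣ (+ x)     = sym (ℤ.pos-* x x)
  i*i≡∣i∣*∣i∣ -[1+ x ] = refl

  ∑sqℤ≡∑sq : ∀ d v → ∑sqℤ d v ≡ + ∑sq d (∣_∣ ∘ v)
  ∑sqℤ≡∑sq zero    v = refl
  ∑sqℤ≡∑sq (suc d) v = trans (cong₂ _+_ (i*i≡∣i∣*∣i∣ (v zero)) (∑sqℤ≡∑sq d (v ∘ suc)))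
                              (sym (ℤ.pos-+ (∣ v zero ∣ ℕ.* ∣ v zero ∣) _))

  sq≤∑sq : ∀ d w (t : Fin d) → w t ℕ.* w t ≤ ∑sq d w
  sq≤∑sq (suc d) w zero    = ℕ.m≤m+n _ _
  sq≤∑sq (suc d) w (suc t) = ℕ.≤-trans (sq≤∑sq d (w ∘ suc) t) (ℕ.m≤n+m _ _)

  ∑sq-≤ : ∀ d b w → (∀ t → w t < b) → ∑sq d w ≤ b ^ 2 ℕ.* d
  ∑sq-≤ zero    b w w<b = ℕ.z≤n
  ∑sq-≤ (suc d) b w w<b = subst (∑sq (suc d) w ≤_) (sym (ℕ.*-suc (b ^ 2) d))
    (ℕ.+-mono-≤ (subst (w zero ℕ.* w zero ≤_) (cong (b ℕ.*_) (sym (ℕ.*-identityʳ b)))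
                        (ℕ.*-mono-≤ (ℕ.<⇒≤ (w<b zero)) (ℕ.<⇒≤ (w<b zero))))
                (∑sq-≤ d b (w ∘ suc) (w<b ∘ suc)))

  Poly≤-∑sq : ∀ e d (B : Fin d → ℤ → ℤ) → (∀ t → Poly≤ e (B t)) → Poly≤ (e ℕ.+ e) (λ J → ∑sqℤ d (λ t → B t J))
  Poly≤-∑sq e zero    B B-poly = Poly≤-const (e ℕ.+ e) 0ℤ
  Poly≤-∑sq e (suc d) B B-poly =
    Poly≤-+ (Poly≤-* (B-poly zero) (B-poly zero)) (Poly≤-∑sq e d (B ∘ suc) (B-poly ∘ suc))

  ∑sq-nonconstant : ∀ e d (B : Fin d → ℤ → ℤ) → (∀ t → Poly≤ e (B t)) →
                    ∀ t {J₁} → B t J₁ ≢ B t 0ℤ → ∃ λ J → ∑sqℤ d (λ t → B t J) ≢ ∑sqℤ d (λ t → B t 0ℤ)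
  ∑sq-nonconstant e d B B-poly t Bt-nonconst
    with Poly≤-unbounded (B-poly t) Bt-nonconst (∑sq d (λ t → ∣ B t 0ℤ ∣))
  ... | J , S₀<∣BtJ∣ = J , λ S≡S₀ → ℕ.<⇒≢ S₀<S (sym (ℤ.+-injective (begin
      + ∑sq d (λ t → ∣ B t J ∣)   ≡⟨ ∑sqℤ≡∑sq d (λ t → B t J) ⟨
      ∑sqℤ d (λ t → B t J)        ≡⟨ S≡S₀ ⟩
      ∑sqℤ d (λ t → B t 0ℤ)       ≡⟨ ∑sqℤ≡∑sq d (λ t → B t 0ℤ) ⟩
      + ∑sq d (λ t → ∣ B t 0ℤ ∣)  ∎)))
    where
    open ≡-Reasoning
    S₀<S : ∑sq d (λ t → ∣ B t 0ℤ ∣) < ∑sq d (λ t → ∣ B t J ∣)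
    S₀<S = ℕ.<-≤-trans S₀<∣BtJ∣ (ℕ.≤-trans ∣BtJ∣≤∣BtJ∣² (sq≤∑sq d (λ t → ∣ B t J ∣) t))
      where ∣BtJ∣≤∣BtJ∣² = ℕ.m≤m*n (∣ B t J ∣) (∣ B t J ∣) {{ℕ.>-nonZero (ℕ.≤-<-trans ℕ.z≤n S₀<∣BtJ∣)}}

module Digits (n : ℕ) .{{_ : NonZero n}} where

  open BaseExpansion n using (value)
  open import Data.Nat
  open import Data.Nat.Properties
  open import Data.Nat.DivMod
  open import Data.Integer as ℤ using (ℤ; +_)
  import Data.Integer.Properties as ℤ
  open import Data.Fin using (Fin; zero; suc)
  open import Function using (_∘_)
  open import Relation.Binary.PropositionalEquality

  digits : ∀ d → ℕ → Fin d → ℕ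
  digits (suc d) i zero    = i % n
  digits (suc d) i (suc t) = digits d (i / n) t

  digits-< : ∀ d i t → digits d i t < n
  digits-< (suc d) i zero    = m%n<n i n
  digits-< (suc d) i (suc t) = digits-< d (i / n) t

  value-digits : ∀ d i → i < n ^ d → value d (+_ ∘ digits d i) ≡ + i
  value-digits zero    zero    _ = refl
  value-digits zero    (suc i) (s<s ())
  value-digits (suc d) i i<nⁿ = begin
    + (i % n) ℤ.+ + n ℤ.* value d (+_ ∘ digits d (i / n))
      ≡⟨ cong (λ v → + (i % n) ℤ.+ + n ℤ.* v) (value-digits d (i / n) i/n<) ⟩
    + (i % n) ℤ.+ + n ℤ.* + (i / n)
      ≡⟨ cong (ℤ._+_ (+ (i % n))) (ℤ.pos-* n (i / n)) ⟨
    + (i % n + n * (i / n))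
      ≡⟨ cong +_ (trans (m≡m%n+[m/n]*n i n) (cong (_+_ (i % n)) (*-comm (i / n) n))) ⟨
    + i
      ∎
    where
    open ≡-Reasoning
    i/n< : i / n < n ^ d
    i/n< = m<n*o⇒m/o<n (subst (i <_) (*-comm n (n ^ d)) i<nⁿ)

  module _ {x : ℕ} (y : ℕ) (x<n : x < n) where

    [x+y*n]%n≡x : (x + y * n) % n ≡ x
    [x+y*n]%n≡x = trans ([m+kn]%n≡m%n x y n) (m<n⇒m%n≡m x<n)

    [x+y*n]/n≡y : (x + y * n) / n ≡ y
    [x+y*n]/n≡y = trans (+-distrib-/ x (y * n) x%n+yn%n<n) (cong₂ _+_ (m<n⇒m/n≡0 x<n) (m*n/n≡m y n))
      where x%n+yn%n<n : x % n + (y * n) % n < n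
            x%n+yn%n<n = subst (_< n) (sym (cong₂ _+_ (m<n⇒m%n≡m x<n) (m*n%n≡0 y n))) (subst (_< n) (sym (+-identityʳ x)) x<n)

module Arithmetic where

  open import Data.Nat
  open import Data.Nat.Properties
  open import Data.Nat.Tactic.RingSolver using (solve-∀)
  open import Relation.Binary.PropositionalEquality

  [m*n]^k≡m^k*n^k : ∀ m n k → (m * n) ^ k ≡ m ^ k * n ^ k
  [m*n]^k≡m^k*n^k m n zero    = refl
  [m*n]^k≡m^k*n^k m n (suc k) = trans (cong (m * n *_) ([m*n]^k≡m^k*n^k m n k)) (lemma m n (m ^ k) (n ^ k))
    where lemma : ∀ m n x y → m * n * (x * y) ≡ m * x * (n * y)
          lemma = solve-∀

  rescale : ∀ {n c q b r L} d → 1 ≤ d → n ≤ c * suc q → suc q ^ d * b ≤ (L + L) * r →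
            n ^ d * b ≤ r * ((2 * c) ^ d * L)
  rescale {n} {c} {q} {b} {r} {L} d d≥1 n≤c[1+q] [1+q]ᵈb≤2Lr = begin
    n ^ d * b                   ≤⟨ *-monoˡ-≤ b (^-monoˡ-≤ d n≤c[1+q]) ⟩
    (c * suc q) ^ d * b         ≡⟨ cong (_* b) ([m*n]^k≡m^k*n^k c (suc q) d) ⟩
    c ^ d * suc q ^ d * b       ≡⟨ *-assoc (c ^ d) _ b ⟩
    c ^ d * (suc q ^ d * b)     ≤⟨ *-monoʳ-≤ (c ^ d) [1+q]ᵈb≤2Lr ⟩
    c ^ d * ((L + L) * r)       ≤⟨ *-monoʳ-≤ (c ^ d) (*-monoˡ-≤ r L+L≤2ᵈL) ⟩
    c ^ d * (2 ^ d * L * r)     ≡⟨ lemma (c ^ d) (2 ^ d) L r ⟩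
    r * (2 ^ d * c ^ d * L)     ≡⟨ cong (λ x → r * (x * L)) ([m*n]^k≡m^k*n^k 2 c d) ⟨
    r * ((2 * c) ^ d * L)       ∎
    where
    open ≤-Reasoning
    L+L≤2ᵈL : L + L ≤ 2 ^ d * L
    L+L≤2ᵈL = begin
      L + L     ≡⟨ cong (_+_ L) (+-identityʳ L) ⟨
      2 * L     ≤⟨ *-monoˡ-≤ L (^-monoʳ-≤ 2 d≥1) ⟩
      2 ^ d * L ∎
    lemma : ∀ a p l r → a * (p * l * r) ≡ r * (p * a * l)
    lemma = solve-∀

module Construction (m k : ℕ) where

  open Polynomial
  open SumOfSquares
  open RangeSum
  open SubsetCounting
  open import Data.Nat
  open import Data.Nat.Properties
  open import Data.Nat.DivMod
  open import Data.Nat.Divisibility using (_∣_; ∣-trans; m∣m*n; m≤n⇒m!∣n!)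
  open import Data.Nat.Tactic.RingSolver using (solve-∀)
  open import Data.Integer.Tactic.RingSolver using () renaming (solve-∀ to ℤ-solve-∀)
  open import Data.Integer as ℤ using (ℤ; +_; 0ℤ)
  import Data.Integer.Properties as ℤ
  open import Data.Bool using (Bool; true; false; _∧_; T)
  open import Data.Bool.Properties using (T-∧; T-≡)
  open import Data.Fin as Fin using (Fin; toℕ)
  open import Data.Fin.Properties using (toℕ<n; ¬∀⟶∃¬)
  open import Data.Fin.Subset using (Subset; ∣_∣)
  open import Data.Product using (Σ; ∃; _×_; _,_; proj₁; proj₂)
  open import Function using (_∘_; Equivalence)
  open import Relation.Binary.PropositionalEquality hiding (J)

  F : ℕ
  F = k !

  D : ℕ
  D = F ^ m

  C : ℕ
  C = 2 ^ suc (suc m) * D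

  instance
    D≢0 : NonZero D
    D≢0 = m^n≢0 F m {{k !≢0}}
    C≢0 : NonZero C
    C≢0 = m*n≢0 (2 ^ suc (suc m)) D {{m^n≢0 2 (suc (suc m))}}

  δ∣F : ∀ δ → 1 ≤ δ → δ < k → δ ∣ F
  δ∣F (suc δ) _ δ<k = ∣-trans (m∣m*n (δ !)) (m≤n⇒m!∣n! (<⇒≤ δ<k))

  module _ (m<k : m < k) (n d : ℕ) .{{_ : NonZero n}} where

    open Digits n
    open BaseExpansion n

    Q : ℕ
    Q = n / C

    L : ℕ
    L = n ^ 2 * d

    ν : ℕ → ℕ
    ν i = ∑sq d (digits d i)

    isGoodDigit : ℕ → Bool
    isGoodDigit x = (x % D ≡ᵇ 0) ∧ (x / D ≤ᵇ Q)

    isGood : ℕ → ℕ → Bool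
    isGood zero    i = true
    isGood (suc e) i = isGoodDigit (i % n) ∧ isGood e (i / n)

    isGood⇒isGoodDigit : ∀ e i → T (isGood e i) → ∀ t → T (isGoodDigit (digits e i t))
    isGood⇒isGoodDigit (suc e) i good Fin.zero    = proj₁ (Equivalence.to T-∧ good)
    isGood⇒isGoodDigit (suc e) i good (Fin.suc t) = isGood⇒isGoodDigit e (i / n) (proj₂ (Equivalence.to T-∧ good)) t

    isGoodDigit⇒multiple : ∀ x → T (isGoodDigit x) → x ≡ x / D * D × x / D ≤ Q
    isGoodDigit⇒multiple x good with Equivalence.to T-∧ good
    ... | D∣x , x/D≤Q = trans (m≡m%n+[m/n]*n x D) (cong (_+ x / D * D) (≡ᵇ⇒≡ (x % D) 0 D∣x)) , ≤ᵇ⇒≤ (x / D) Q x/D≤Q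

    2^[m+1]DQ<n : 2 ^ suc m * (D * Q) < n
    2^[m+1]DQ<n = x+x≤n⇒x<n (2 ^ suc m * (D * Q)) (begin
      2 ^ suc m * (D * Q) + 2 ^ suc m * (D * Q) ≡⟨ lemma (2 ^ suc m) D Q ⟩
      Q * C                                     ≤⟨ m/n*n≤m n C ⟩
      n                                         ∎)
      where
      open ≤-Reasoning
      lemma : ∀ p D Q → p * (D * Q) + p * (D * Q) ≡ Q * (2 * p * D)
      lemma = solve-∀
      x+x≤n⇒x<n : ∀ x → x + x ≤ n → x < n
      x+x≤n⇒x<n zero    _     = >-nonZero⁻¹ n
      x+x≤n⇒x<n (suc x) x+x≤n = <-≤-trans (m<m+n (suc x) z<s) x+x≤n

    ν-poly : ∀ {g} → Poly≤ m g → (I : Fin k → ℕ) → (∀ j → I j < n ^ d) → (∀ j → T (isGood d (I j))) →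
                     (∀ j → g (+ toℕ j) ≡ + I j) → ∀ {J₁} → g J₁ ≢ g 0ℤ →
                     Σ (ℤ → ℤ) λ N → Poly≤ (2 * m) N × (∀ j → N (+ toℕ j) ≡ + ν (I j)) × ∃ λ J → N J ≢ N 0ℤ
    ν-poly {g} g-poly I I<nᵈ I-good g-node {J₁} g-nonconst =
      N , N-poly , N-node , ∑sq-nonconstant m d P P-poly t Pt-nonconst
      where
      z : Fin k → Fin d → ℤ
      z j t = + (digits d (I j) t / D)
      digit≡ : ∀ j t → + digits d (I j) t ≡ + D ℤ.* z j t
      digit≡ j t = trans (cong +_ (trans (proj₁ good) (*-comm _ D))) (ℤ.pos-* D _)
        where good = isGoodDigit⇒multiple _ (isGood⇒isGoodDigit d (I j) (I-good j) t)
      ∣digit∣≤DQ : ∀ j t → ℤ.∣ + D ℤ.* z j t ∣ ≤ D * Q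
      ∣digit∣≤DQ j t = subst (_≤ D * Q) (cong ℤ.∣_∣ (digit≡ j t))
        (subst (_≤ D * Q) (sym (trans (proj₁ good) (*-comm _ D))) (*-monoʳ-≤ D (proj₂ good)))
        where good = isGoodDigit⇒multiple _ (isGood⇒isGoodDigit d (I j) (I-good j) t)
      open Digitwise (digitwise F m 0 d z m<k δ∣F 2^[m+1]DQ<n g-poly ∣digit∣≤DQ λ j →
             trans (g-node j) (trans (sym (value-digits d (I j) (I<nᵈ j))) (value-cong d (digit≡ j))))
        renaming (digitPoly to P; digitPoly-poly to P-poly)
      N : ℤ → ℤ
      N J = ∑sqℤ d (λ t → P t J)
      N-poly : Poly≤ (2 * m) N
      N-poly = subst (λ e → Poly≤ e N) (cong (_+_ m) (sym (+-identityʳ m))) (Poly≤-∑sq m d P P-poly)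
      N-node : ∀ j → N (+ toℕ j) ≡ + ν (I j)
      N-node j = trans (∑sqℤ-cong d (λ t → trans (digitPoly-node j t) (sym (digit≡ j t))))
                       (∑sqℤ≡∑sq d (+_ ∘ digits d (I j)))
      nonconst = ¬∀⟶∃¬ d _ (λ t → P t J₁ ℤ.≟ P t 0ℤ) λ P≗ →
        g-nonconst (trans (g≡value J₁) (trans (value-cong d P≗) (sym (g≡value 0ℤ))))
      t = proj₁ nonconst
      Pt-nonconst = proj₂ nonconst

    isGoodDigit-yD : ∀ y → y ≤ Q → 𝟙 (isGoodDigit (y * D)) ≡ 1
    isGoodDigit-yD y y≤Q = trans (cong 𝟙 (cong₂ (λ r q → (r ≡ᵇ 0) ∧ (q ≤ᵇ Q)) (m*n%n≡0 y D) (m*n/n≡m y D)))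
                            (T⇒𝟙≡1 (≤⇒≤ᵇ y≤Q))

    countGoodDigits : suc Q ≤ ∑[ x < n ] 𝟙 (isGoodDigit x)
    countGoodDigits = begin
      suc Q                                          ≡⟨ +-comm 1 Q ⟩
      Q + 1                                          ≡⟨ cong₂ _+_ (trans (∑-const Q 1) (*-identityʳ Q)) (isGoodDigit-yD Q ≤-refl) ⟨
      ∑[ y < Q ] 1 + 𝟙 (isGoodDigit (Q * D))         ≡⟨ cong (_+ 𝟙 (isGoodDigit (Q * D))) (∑-cong Q λ y y<Q → isGoodDigit-yD y (<⇒≤ y<Q)) ⟨
      ∑[ y < Q ] G (y * D) + G (Q * D)               ≤⟨ +-mono-≤ (∑-mono-≤ Q λ y _ → ∑-head D (λ x → G (x + y * D)) (>-nonZero⁻¹ D))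
                                                                 (≤-reflexive (cong G (sym (+-identityʳ (Q * D))))) ⟩
      ∑[ y < Q ] ∑[ x < D ] G (x + y * D) + G (Q * D + 0) ≡⟨ cong₂ _+_ (∑-blocks D Q G) (+-identityʳ _) ⟨
      ∑< (Q * D) G + ∑[ x < 1 ] G (Q * D + x)        ≡⟨ ∑-+ (Q * D) 1 G ⟨
      ∑< (Q * D + 1) G                               ≤⟨ ∑-prefix (Q * D + 1) (n ∸ (Q * D + 1)) G ⟩
      ∑< (Q * D + 1 + (n ∸ (Q * D + 1))) G           ≡⟨ cong (λ M → ∑< M G) (m+[n∸m]≡n QD<n) ⟩
      ∑< n G                                         ∎
      where
      open ≤-Reasoning
      G = 𝟙 ∘ isGoodDigit
      QD<n : Q * D + 1 ≤ n
      QD<n = subst (_≤ n) (+-comm 1 (Q * D))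
        (≤-trans (s≤s (subst (_≤ 2 ^ suc m * (D * Q)) (*-comm D Q) (m≤n*m (D * Q) (2 ^ suc m) {{m^n≢0 2 (suc m)}}))) 2^[m+1]DQ<n)

    countGood : ∀ e → suc Q ^ e ≤ ∑[ i < n ^ e ] 𝟙 (isGood e i)
    countGood zero    = ≤-refl
    countGood (suc e) = begin
      suc Q * suc Q ^ e                                  ≤⟨ *-mono-≤ countGoodDigits (countGood e) ⟩
      ∑< n G * ∑< (n ^ e) H                              ≡⟨ *-comm (∑< n G) _ ⟩
      ∑< (n ^ e) H * ∑< n G                              ≡⟨ ∑-*ʳ (n ^ e) H (∑< n G) ⟨
      ∑[ y < n ^ e ] (H y * ∑< n G)                      ≡⟨ ∑-cong (n ^ e) (λ y _ → trans (∑-*ʳ n G (H y)) (*-comm (∑< n G) (H y))) ⟨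
      ∑[ y < n ^ e ] ∑[ x < n ] (G x * H y)              ≡⟨ ∑-cong (n ^ e) (λ y _ → ∑-cong n λ x x<n → lastDigit x y x<n) ⟨
      ∑[ y < n ^ e ] ∑[ x < n ] 𝟙 (isGood (suc e) (x + y * n)) ≡⟨ ∑-blocks n (n ^ e) (𝟙 ∘ isGood (suc e)) ⟨
      ∑[ i < n ^ e * n ] 𝟙 (isGood (suc e) i)            ≡⟨ cong (λ M → ∑< M (𝟙 ∘ isGood (suc e))) (*-comm (n ^ e) n) ⟩
      ∑[ i < n * n ^ e ] 𝟙 (isGood (suc e) i)            ∎
      where
      open ≤-Reasoning
      G = 𝟙 ∘ isGoodDigit
      H = 𝟙 ∘ isGood e
      lastDigit : ∀ x y → x < n → 𝟙 (isGood (suc e) (x + y * n)) ≡ G x * H y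
      lastDigit x y x<n = trans (cong₂ (λ a b → 𝟙 (isGoodDigit a ∧ isGood e b)) ([x+y*n]%n≡x y x<n) ([x+y*n]/n≡y y x<n))
                                (𝟙-∧ (isGoodDigit x) (isGood e y))

    module _ (B : Subset L) where

      shifted : ℕ → ℕ → Bool
      shifted σ v = (L ≤ᵇ σ + v) ∧ (B ∋ᵇ (σ + v ∸ L))

      -- Each good i lies in A σ for exactly |B| values σ < 2L.
      A : ℕ → Subset (n ^ d)
      A σ = fromBool (n ^ d) (λ i → isGood d i ∧ shifted σ (ν i))

      shifted⇒HasConfig : ∀ {e N} σ → Poly≤ e N → ∀ {J} → N J ≢ N 0ℤ → (v : Fin k → ℕ) →
                          (∀ j → N (+ toℕ j) ≡ + v j) → (∀ j → T (shifted σ (v j))) → HasConfig e k L B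
      shifted⇒HasConfig {e} {N} σ (x , c , N≡) {J} N-nonconst v N-node v-shifted =
        x ℤ.+ (+ σ ℤ.- + L) , c , nonconstant⇒coeff≢0 x c N≡ J N-nonconst , member
        where
        member : ∀ j → (x ℤ.+ (+ σ ℤ.- + L) ℤ.+ polySum e c (+ toℕ j)) ∈ℤ B
        member j = subst (_∈ℤ B) shift≡ (∋ᵇ⇒∈ℤ B (σ + v j ∸ L) (proj₂ shifted-j))
          where
          open ≡-Reasoning
          shifted-j = Equivalence.to T-∧ (v-shifted j)
          lemma : ∀ x p s l → s ℤ.+ (x ℤ.+ p) ℤ.- l ≡ x ℤ.+ (s ℤ.- l) ℤ.+ p
          lemma = ℤ-solve-∀
          shift≡ : + (σ + v j ∸ L) ≡ x ℤ.+ (+ σ ℤ.- + L) ℤ.+ polySum e c (+ toℕ j)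
          shift≡ = begin
            + (σ + v j ∸ L)                    ≡⟨ ℤ.⊖-≥ (≤ᵇ⇒≤ L (σ + v j) (proj₁ shifted-j)) ⟨
            (σ + v j) ℤ.⊖ L                    ≡⟨ ℤ.m-n≡m⊖n (σ + v j) L ⟨
            + (σ + v j) ℤ.- + L                ≡⟨ cong (ℤ._- + L) (ℤ.pos-+ σ (v j)) ⟩
            + σ ℤ.+ + v j ℤ.- + L              ≡⟨ cong (λ u → + σ ℤ.+ u ℤ.- + L) (trans (sym (N-node j)) (N≡ (+ toℕ j))) ⟩
            + σ ℤ.+ (x ℤ.+ polySum e c (+ toℕ j)) ℤ.- + L ≡⟨ lemma x (polySum e c (+ toℕ j)) (+ σ) (+ L) ⟩
            x ℤ.+ (+ σ ℤ.- + L) ℤ.+ polySum e c (+ toℕ j) ∎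

      A-free : Free (2 * m) k L B → ∀ σ → Free m k (n ^ d) (A σ)
      A-free B-free σ (x , a , (i₀ , aᵢ₀≢0) , x+P∈A) =
        let (N , N-poly , N-node , J , N-nonconst) =
              ν-poly (x , a , λ _ → refl) I I<nᵈ (proj₁ ∘ I∈A) I-node g-nonconst
        in B-free (shifted⇒HasConfig σ N-poly N-nonconst (ν ∘ I) N-node (proj₂ ∘ I∈A))
        where
        I : Fin k → ℕ
        I j = toℕ (proj₁ (x+P∈A j))
        I<nᵈ : ∀ j → I j < n ^ d
        I<nᵈ j = toℕ<n (proj₁ (x+P∈A j))
        I-node : ∀ j → x ℤ.+ polySum m a (+ toℕ j) ≡ + I j
        I-node j = sym (proj₁ (proj₂ (x+P∈A j)))
        I∈A : ∀ j → T (isGood d (I j)) × T (shifted σ (ν (I j)))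
        I∈A j = Equivalence.to T-∧
          (∈fromBool (n ^ d) (λ i → isGood d i ∧ shifted σ (ν i)) (proj₁ (x+P∈A j)) (proj₂ (proj₂ (x+P∈A j))))
        g-nonconst = proj₂ (coeff≢0⇒nonconstant x a (λ _ → refl) i₀ aᵢ₀≢0)

      countShifts : ∀ v → v ≤ L → ∣ B ∣ ≤ ∑[ σ < L + L ] 𝟙 (shifted σ v)
      countShifts v v≤L = begin
        ∣ B ∣                               ≡⟨ ∣p∣≡∑ B ⟩
        ∑[ i < L ] 𝟙 (B ∋ᵇ i)               ≡⟨ ∑-cong L (λ i _ → cong 𝟙 (shifted-s+i i)) ⟨
        ∑[ i < L ] f (s + i)                ≤⟨ ∑-prefix L v (λ i → f (s + i)) ⟩
        ∑[ i < L + v ] f (s + i)            ≤⟨ m≤n+m _ (∑< s f) ⟩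
        ∑< s f + ∑[ i < L + v ] f (s + i)   ≡⟨ ∑-+ s (L + v) f ⟨
        ∑< (s + (L + v)) f                  ≡⟨ cong (λ M → ∑< M f) s+[L+v]≡L+L ⟩
        ∑< (L + L) f                        ∎
        where
        open ≤-Reasoning
        s = L ∸ v
        f = λ σ → 𝟙 (shifted σ v)
        s+v≡L : s + v ≡ L
        s+v≡L = m∸n+n≡m v≤L
        s+[L+v]≡L+L : s + (L + v) ≡ L + L
        s+[L+v]≡L+L = trans (cong (_+_ s) (+-comm L v)) (trans (sym (+-assoc s v L)) (cong (_+ L) s+v≡L))
        shifted-s+i : ∀ i → shifted (s + i) v ≡ B ∋ᵇ i
        shifted-s+i i rewrite +-assoc s i v | +-comm i v | sym (+-assoc s v i) | s+v≡L =
          cong₂ _∧_ (Equivalence.to T-≡ (≤⇒≤ᵇ (m≤m+n L i))) (cong (B ∋ᵇ_) (m+n∸m≡n L i))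

      ∑∣A∣ : suc Q ^ d * ∣ B ∣ ≤ ∑[ σ < L + L ] ∣ A σ ∣
      ∑∣A∣ = begin
        suc Q ^ d * ∣ B ∣                        ≤⟨ *-monoˡ-≤ ∣ B ∣ (countGood d) ⟩
        ∑[ i < n ^ d ] 𝟙 (isGood d i) * ∣ B ∣    ≡⟨ ∑-*ʳ (n ^ d) (𝟙 ∘ isGood d) ∣ B ∣ ⟨
        ∑[ i < n ^ d ] (𝟙 (isGood d i) * ∣ B ∣)  ≤⟨ ∑-mono-≤ (n ^ d) (λ i _ → countShifts-ifGood i) ⟩
        ∑[ i < n ^ d ] ∑[ σ < L + L ] 𝟙 (χ σ i)  ≡⟨ ∑-comm (n ^ d) (L + L) (λ i σ → 𝟙 (χ σ i)) ⟩
        ∑[ σ < L + L ] ∑[ i < n ^ d ] 𝟙 (χ σ i)  ≡⟨ ∑-cong (L + L) (λ σ _ → ∣fromBool∣ (n ^ d) (χ σ)) ⟨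
        ∑[ σ < L + L ] ∣ A σ ∣                   ∎
        where
        open ≤-Reasoning
        χ : ℕ → ℕ → Bool
        χ σ i = isGood d i ∧ shifted σ (ν i)
        countShifts-ifGood : ∀ i → 𝟙 (isGood d i) * ∣ B ∣ ≤ ∑[ σ < L + L ] 𝟙 (χ σ i)
        countShifts-ifGood i with isGood d i
        ... | true  = subst (_≤ ∑[ σ < L + L ] 𝟙 (shifted σ (ν i))) (sym (+-identityʳ ∣ B ∣))
                            (countShifts (ν i) (∑sq-≤ d n (digits d i) (digits-< d i)))
        ... | false = z≤n

    n≤C*[1+Q] : n ≤ C * suc Q
    n≤C*[1+Q] = begin
      n                 ≡⟨ m≡m%n+[m/n]*n n C ⟩
      n % C + Q * C     ≤⟨ +-monoˡ-≤ (Q * C) (<⇒≤ (m%n<n n C)) ⟩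
      C + Q * C         ≡⟨ cong (_+_ C) (*-comm Q C) ⟩
      C + C * Q         ≡⟨ *-suc C Q ⟨
      C * suc Q         ∎
      where open ≤-Reasoning

    r₂-bound : 1 ≤ d → ∀ {r₁ r₂} → IsR m k (n ^ d) r₁ → IsR (2 * m) k L r₂ → n ^ d * r₂ ≤ r₁ * ((2 * C) ^ d * L)
    r₂-bound d≥1 {r₁} (_ , max₁) ((B , B-free , refl) , _) =
      Arithmetic.rescale {c = C} {r = r₁} {L = L} d d≥1 n≤C*[1+Q]
        (≤-trans (∑∣A∣ B) (∑-≤-* (L + L) _ λ σ _ → max₁ (A B σ) (A-free B B-free σ)))

open import Data.Nat using (suc; _*_; _^_; _≤_; _≥_; >-nonZero; >-nonZero⁻¹)
open import Data.Nat.Properties using (m*n≢0)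
open import Data.Product using (Σ; _×_; _,_)

proposition2p2 : (m k : ℕ) → m ≥ 1 → k ≥ suc m →
    Σ ℕ λ c → (c ≥ 1) ×
      ((n d : ℕ) → n ≥ 1 → d ≥ 1 → (r₁ r₂ : ℕ) →
        IsR m k (n ^ d) r₁ → IsR (2 * m) k (n ^ 2 * d) r₂ →
        (n ^ d) * r₂ ≤ r₁ * (c ^ d * (n ^ 2 * d)))
proposition2p2 m k _ m<k =
  2 * C , >-nonZero⁻¹ (2 * C) {{m*n≢0 2 C}} ,
  λ n d n≥1 d≥1 r₁ r₂ → r₂-bound m<k n d {{>-nonZero n≥1}} d≥1
  where open Construction m k
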